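{- Let $s$ be a positive integer with $s\equiv 2\pmod 4$. Then every colouring of $\mathbb{Z}^3$ with $s$ colours contains a monochromatic pair of points $(x,y,z),(x',y',z')\in\mathbb{Z}^3$ with \[(x-x')^2+(y-y')^2-(z-z')^2=\left(5^{(s-2)/4}\,\bigl(8\cdot 5^{(s-2)/2}\bigr)!\right)^2.\] -}

module Defs where

open import Data.Nat as ℕ using (ℕ; _!)
open import Data.Nat.DivMod using (_/_)
open import Data.Integer using (ℤ; +_; _-_; _+_; _*_)
open import Data.Product using (_×_)

ℤ³ : Set
ℤ³ = ℤ × ℤ × ℤ

lor : ℤ → ℤ → ℤ → ℤ → ℤ → ℤ → ℤ
lor x y z x' y' z' =
  ((x - x') * (x - x') + (y - y') * (y - y')) - (z - z') * (z - z')

-- the target value (5^((s-2)/4) · (8 · 5^((s-2)/2))!)²  (natural-number arithmetic;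
-- for s ≡ 2 mod 4 the divisions are exact)
target : ℕ → ℕ
target s = let t = (5 ℕ.^ ((s ℕ.∸ 2) / 4)) ℕ.* ((8 ℕ.* (5 ℕ.^ ((s ℕ.∸ 2) / 2))) !)
           in t ℕ.* t

-- The points a (1 − ij, i + j, 1 + ij) are chosen so that the squared Lorentzian distance between
-- a (1 − ij, i + j, 1 + ij) and b (1 − jk, j + k, 1 + jk) is the square (a (j − i) + b (k − j))².
-- Scaling the point of the edge i < j by K · L! / (j − i) therefore makes the points of any two
-- consecutive edges (i , j), (j , k) with k ≤ L lie at squared distance (2 K · L!)². Colour each edge by
-- the colour of its point; among the 2 ^ s + 1 vertices j ≤ 2 ^ s two, u < v, have the same set of
-- colours on the edges below them, so the colour of (u , v) also occurs on some edge (i , u).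
-- For s = 4e + 2 the choice L = 8 · 5^(2e) − 1 ≥ 2 ^ s and K = 4 · 5^(3e) gives
-- 2 K · L! = 5^e · (8 · 5^(2e))!.
module Submission where

open import Defs
open import Data.Nat using (ℕ; _%_; _>_)
open import Data.Fin using (Fin)
open import Data.Integer using (+_)
open import Data.Product using (Σ; _×_; _,_)
open import Relation.Binary.PropositionalEquality using (_≡_)

open import Data.Nat as ℕ using (zero; suc; _≤_; _<_; _!)
import Data.Nat.Properties as ℕₚ
open import Data.Nat.DivMod using (_/_; m*[n/m]≡n; m*n/n≡m; m≡m%n+[m/n]*n)
open import Data.Nat.Divisibility using (∣-trans; m∣m*n; m≤n⇒m!∣n!)
import Data.Nat.Tactic.RingSolver as ℕ-Solver
open import Data.Integer using (ℤ; 1ℤ; _+_; _-_; _*_)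
import Data.Integer.Properties as ℤₚ
open import Data.Integer.Tactic.RingSolver using (solve-∀)
open import Data.Fin as Fin using (toℕ; fromℕ<; funToFin)
import Data.Fin.Properties as Finₚ
open import Data.Product using (∃)
open import Relation.Nullary using (Dec; yes; no)
open import Data.Empty using (⊥-elim)
open import Relation.Binary.PropositionalEquality
  using (_≗_; refl; sym; trans; cong; cong₂; module ≡-Reasoning)

lor³ : ℤ³ → ℤ³ → ℤ
lor³ (x , y , z) (x' , y' , z') = lor x y z x' y' z'

conePoint : ℤ → ℤ → ℤ → ℤ³
conePoint a i j = a * (1ℤ - i * j) , a * (i + j) , a * (1ℤ + i * j)

lor³-conePoint : ∀ a b i j k →
  lor³ (conePoint a i j) (conePoint b j k) ≡
  (a * (j - i) + b * (k - j)) * (a * (j - i) + b * (k - j))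
lor³-conePoint = expanded
  where
  expanded : ∀ a b i j k →
    ((a * (1ℤ - i * j) - b * (1ℤ - j * k)) * (a * (1ℤ - i * j) - b * (1ℤ - j * k))
      + (a * (i + j) - b * (j + k)) * (a * (i + j) - b * (j + k)))
      - (a * (1ℤ + i * j) - b * (1ℤ + j * k)) * (a * (1ℤ + i * j) - b * (1ℤ + j * k))
    ≡ (a * (j - i) + b * (k - j)) * (a * (j - i) + b * (k - j))
  expanded = solve-∀

pos-∸ : ∀ {m n} → m ≤ n → + n - + m ≡ + (n ℕ.∸ m)
pos-∸ {m} {n} m≤n = trans (ℤₚ.[+m]-[+n]≡m⊖n n m) (ℤₚ.⊖-≥ m≤n)

lor³-conePoint-≡ : ∀ a b {i j k T} → i ≤ j → j ≤ k →
  a ℕ.* (j ℕ.∸ i) ≡ T → b ℕ.* (k ℕ.∸ j) ≡ T →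
  lor³ (conePoint (+ a) (+ i) (+ j)) (conePoint (+ b) (+ j) (+ k)) ≡ + (2 ℕ.* T ℕ.* (2 ℕ.* T))
lor³-conePoint-≡ a b {i} {j} {k} {T} i≤j j≤k aT bT = begin
  lor³ (conePoint (+ a) (+ i) (+ j)) (conePoint (+ b) (+ j) (+ k))
    ≡⟨ lor³-conePoint (+ a) (+ b) (+ i) (+ j) (+ k) ⟩
  (+ a * (+ j - + i) + + b * (+ k - + j)) * (+ a * (+ j - + i) + + b * (+ k - + j))
    ≡⟨ cong (λ t → t * t) (cong₂ _+_ (scaled-gap a i≤j aT) (scaled-gap b j≤k bT)) ⟩
  (+ T + + T) * (+ T + + T)
    ≡⟨ cong (λ t → t * t) (sym (ℤₚ.pos-+ T T)) ⟩
  + (T ℕ.+ T) * + (T ℕ.+ T)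
    ≡⟨ sym (ℤₚ.pos-* (T ℕ.+ T) (T ℕ.+ T)) ⟩
  + ((T ℕ.+ T) ℕ.* (T ℕ.+ T))
    ≡⟨ cong (λ t → + (t ℕ.* t)) (cong (T ℕ.+_) (sym (ℕₚ.+-identityʳ T))) ⟩
  + (2 ℕ.* T ℕ.* (2 ℕ.* T)) ∎
  where
  open ≡-Reasoning

  scaled-gap : ∀ c {m n} → m ≤ n → c ℕ.* (n ℕ.∸ m) ≡ T → + c * (+ n - + m) ≡ + T
  scaled-gap c {m} {n} m≤n cT = begin
    + c * (+ n - + m)      ≡⟨ cong (+ c *_) (pos-∸ m≤n) ⟩
    + c * + (n ℕ.∸ m)      ≡⟨ sym (ℤₚ.pos-* c (n ℕ.∸ m)) ⟩
    + (c ℕ.* (n ℕ.∸ m))    ≡⟨ cong +_ cT ⟩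
    + T                    ∎

indicator : {P : Set} → Dec P → Fin 2
indicator (yes _) = Fin.suc Fin.zero
indicator (no _)  = Fin.zero

indicator-reflects : {P Q : Set} (p? : Dec P) (q? : Dec Q) → indicator p? ≡ indicator q? → Q → P
indicator-reflects (yes p) _       _  _ = p
indicator-reflects (no _)  (yes _) () _
indicator-reflects (no _)  (no ¬q) _  q = ⊥-elim (¬q q)

funToFin-injective : ∀ {m n} (f g : Fin m → Fin n) → funToFin f ≡ funToFin g → f ≗ g
funToFin-injective f g eq x = begin
  f x                          ≡⟨ sym (Finₚ.finToFun-funToFin f x) ⟩
  Fin.finToFun (funToFin f) x  ≡⟨ cong (λ y → Fin.finToFun y x) eq ⟩
  Fin.finToFun (funToFin g) x  ≡⟨ Finₚ.finToFun-funToFin g x ⟩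
  g x                          ∎
  where open ≡-Reasoning

module _ {s : ℕ} (colour : ℕ → ℕ → Fin s) where

  colourBelow? : (j : ℕ) (c : Fin s) → Dec (∃ λ (i : Fin j) → colour (toℕ i) j ≡ c)
  colourBelow? j c = Finₚ.any? (λ i → colour (toℕ i) j Finₚ.≟ c)

  coloursBelow : ℕ → Fin s → Fin 2
  coloursBelow j c = indicator (colourBelow? j c)

  monochromatic-path : ∃ λ i → ∃ λ j → ∃ λ k →
    i < j × j < k × k ≤ 2 ℕ.^ s × colour i j ≡ colour j k
  monochromatic-path
    with u , v , u<v , same ← Finₚ.pigeonhole (ℕₚ.n<1+n (2 ℕ.^ s)) (λ u → funToFin (coloursBelow (toℕ u)))
    with i , iu≡uv ← indicator-reflects (colourBelow? (toℕ u) (colour (toℕ u) (toℕ v)))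
                                        (colourBelow? (toℕ v) (colour (toℕ u) (toℕ v)))
                                        (funToFin-injective _ _ same (colour (toℕ u) (toℕ v)))
                                        (fromℕ< u<v , cong (λ w → colour w (toℕ v)) (Finₚ.toℕ-fromℕ< u<v))
    = toℕ i , toℕ u , toℕ v , Finₚ.toℕ<n i , u<v , Finₚ.toℕ≤pred[n] v , iu≡uv

cofactor : ℕ → ℕ → ℕ
cofactor L zero    = 0
cofactor L (suc d) = L ! / suc d

cofactor-* : ∀ L {d} → 0 < d → d ≤ L → cofactor L d ℕ.* d ≡ L !
cofactor-* L {suc d} _ d≤L =
  trans (ℕₚ.*-comm (L ! / suc d) (suc d)) (m*[n/m]≡n (∣-trans (m∣m*n (d !)) (m≤n⇒m!∣n! d≤L)))

MonochromaticPairAt : ∀ {s} → (ℤ³ → Fin s) → ℕ → Set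
MonochromaticPairAt c d = Σ ℤ³ λ p → Σ ℤ³ λ q → c p ≡ c q × lor³ p q ≡ + d

module _ (L K : ℕ) where

  weight : ℕ → ℕ → ℕ
  weight i j = K ℕ.* cofactor L (j ℕ.∸ i)

  point : ℕ → ℕ → ℤ³
  point i j = conePoint (+ weight i j) (+ i) (+ j)

  weight-* : ∀ {i j} → i < j → j ≤ L → weight i j ℕ.* (j ℕ.∸ i) ≡ K ℕ.* L !
  weight-* {i} {j} i<j j≤L = trans
    (ℕₚ.*-assoc K (cofactor L (j ℕ.∸ i)) (j ℕ.∸ i))
    (cong (K ℕ.*_) (cofactor-* L (ℕₚ.m<n⇒0<n∸m i<j) (ℕₚ.≤-trans (ℕₚ.m∸n≤m j i) j≤L)))

  monochromatic-pair : ∀ {s} → 2 ℕ.^ s ≤ L → (c : ℤ³ → Fin s) →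
    MonochromaticPairAt c (2 ℕ.* (K ℕ.* L !) ℕ.* (2 ℕ.* (K ℕ.* L !)))
  monochromatic-pair 2^s≤L c
    with i , j , k , i<j , j<k , k≤2^s , same ← monochromatic-path (λ i j → c (point i j))
    = point i j , point j k , same ,
      lor³-conePoint-≡ (weight i j) (weight j k) (ℕₚ.<⇒≤ i<j) (ℕₚ.<⇒≤ j<k)
        (weight-* i<j (ℕₚ.<⇒≤ (ℕₚ.<-≤-trans j<k k≤L)))
        (weight-* j<k k≤L)
    where
    k≤L : k ≤ L
    k≤L = ℕₚ.≤-trans k≤2^s 2^s≤L

factorial-halve : ∀ x m n → suc n ≡ 2 ℕ.* m → x ℕ.* suc n ! ≡ 2 ℕ.* (x ℕ.* m ℕ.* n !)
factorial-halve x m n n+1≡2m = trans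
  (cong (λ t → x ℕ.* (t ℕ.* n !)) n+1≡2m)
  (reassociate x m (n !))
  where
  reassociate : ∀ x m f → x ℕ.* (2 ℕ.* m ℕ.* f) ≡ 2 ℕ.* (x ℕ.* m ℕ.* f)
  reassociate = ℕ-Solver.solve-∀

target-2+e*4 : ∀ e → target (2 ℕ.+ e ℕ.* 4) ≡
  5 ℕ.^ e ℕ.* (8 ℕ.* 5 ℕ.^ (e ℕ.* 2)) ! ℕ.* (5 ℕ.^ e ℕ.* (8 ℕ.* 5 ℕ.^ (e ℕ.* 2)) !)
target-2+e*4 e = cong₂ (λ a b → let t = 5 ℕ.^ a ℕ.* (8 ℕ.* 5 ℕ.^ b) ! in t ℕ.* t)
  (m*n/n≡m e 4)
  (trans (cong (_/ 2) (sym (ℕₚ.*-assoc e 2 2))) (m*n/n≡m (e ℕ.* 2) 2))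

module _ (e : ℕ) where

  N : ℕ
  N = 5 ℕ.^ (e ℕ.* 2)

  N≢0 : ℕ.NonZero N
  N≢0 = ℕₚ.m^n≢0 5 (e ℕ.* 2)

  L : ℕ
  L = ℕ.pred (8 ℕ.* N)

  K : ℕ
  K = 5 ℕ.^ e ℕ.* (4 ℕ.* N)

  1+L≡8N : suc L ≡ 8 ℕ.* N
  1+L≡8N = ℕₚ.suc-pred (8 ℕ.* N) {{ℕₚ.m*n≢0 8 N {{_}} {{N≢0}}}}

  target≡[2KL!]² : target (2 ℕ.+ e ℕ.* 4) ≡ 2 ℕ.* (K ℕ.* L !) ℕ.* (2 ℕ.* (K ℕ.* L !))
  target≡[2KL!]² = begin
    target (2 ℕ.+ e ℕ.* 4)
      ≡⟨ target-2+e*4 e ⟩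
    5 ℕ.^ e ℕ.* (8 ℕ.* N) ! ℕ.* (5 ℕ.^ e ℕ.* (8 ℕ.* N) !)
      ≡⟨ cong (λ n → 5 ℕ.^ e ℕ.* n ! ℕ.* (5 ℕ.^ e ℕ.* n !)) (sym 1+L≡8N) ⟩
    5 ℕ.^ e ℕ.* suc L ! ℕ.* (5 ℕ.^ e ℕ.* suc L !)
      ≡⟨ cong (λ t → t ℕ.* t) (factorial-halve (5 ℕ.^ e) (4 ℕ.* N) L (trans 1+L≡8N (ℕₚ.*-assoc 2 4 N))) ⟩
    2 ℕ.* (K ℕ.* L !) ℕ.* (2 ℕ.* (K ℕ.* L !)) ∎
    where open ≡-Reasoning

  2^[2+e*4]≤L : 2 ℕ.^ (2 ℕ.+ e ℕ.* 4) ≤ L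
  2^[2+e*4]≤L = ℕₚ.<⇒≤pred (begin-strict
    2 ℕ.^ (2 ℕ.+ e ℕ.* 4)   ≡⟨ ℕₚ.^-distribˡ-+-* 2 2 (e ℕ.* 4) ⟩
    4 ℕ.* 2 ℕ.^ (e ℕ.* 4)   ≡⟨ cong (4 ℕ.*_) (power-of-power 2 4) ⟩
    4 ℕ.* 16 ℕ.^ e          ≤⟨ ℕₚ.*-monoʳ-≤ 4 (ℕₚ.^-monoˡ-≤ e (ℕₚ.m≤m+n 16 9)) ⟩
    4 ℕ.* 25 ℕ.^ e          ≡⟨ cong (4 ℕ.*_) (sym (power-of-power 5 2)) ⟩
    4 ℕ.* N                 <⟨ ℕₚ.*-monoˡ-< N {{N≢0}} (ℕₚ.m<m+n 4 {4} ℕ.z<s) ⟩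
    8 ℕ.* N                 ∎)
    where
    open ℕₚ.≤-Reasoning

    power-of-power : ∀ m n → m ℕ.^ (e ℕ.* n) ≡ (m ℕ.^ n) ℕ.^ e
    power-of-power m n = trans (cong (m ℕ.^_) (ℕₚ.*-comm e n)) (sym (ℕₚ.^-*-assoc m n e))

m%4≡2⇒m≡2+[m/4]*4 : ∀ m → m % 4 ≡ 2 → m ≡ 2 ℕ.+ m / 4 ℕ.* 4
m%4≡2⇒m≡2+[m/4]*4 m m%4≡2 = trans (m≡m%n+[m/n]*n m 4) (cong (ℕ._+ m / 4 ℕ.* 4) m%4≡2)

monochromatic-pair-at-target : ∀ {s} e → s ≡ 2 ℕ.+ e ℕ.* 4 → (c : ℤ³ → Fin s) →
  MonochromaticPairAt c (target s)
monochromatic-pair-at-target e refl c =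
  let p , q , same , dist = monochromatic-pair (L e) (K e) (2^[2+e*4]≤L e) c
  in  p , q , same , trans dist (cong +_ (sym (target≡[2KL!]² e)))

theorem4 : (s : ℕ) → s > 0 → s % 4 ≡ 2 → (c : ℤ³ → Fin s) →
    Σ ℤ³ λ { (x , y , z) → Σ ℤ³ λ { (x' , y' , z') →
      (c (x , y , z) ≡ c (x' , y' , z')) × (lor x y z x' y' z' ≡ + target s) } }
theorem4 s _ s%4≡2 c = monochromatic-pair-at-target (s / 4) (m%4≡2⇒m≡2+[m/4]*4 s s%4≡2) c
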